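{- Let $k>1$ and let $c=(c_1,\ldots,c_k)$ be a composition (of a positive integer) into $k$ nonnegative parts. Then $$F_c(y,q)=\sum_{\emptyset\ne J\subseteq I_c}(-1)^{|J|-1}\frac{F_{c(J)}(yq^{|J|},q)}{1-yq^{|J|}},$$ and moreover $F_c(0,q)=1$ and $F_c(y,0)=1$.
   Context: Partitions are weakly decreasing sequences $\lambda=(\lambda_1,\lambda_2,\ldots)$ of nonnegative integers with finitely many nonzero terms. For a composition $c=(c_1,\ldots,c_k)$ into $k$ nonnegative parts, a cylindric partition of profile $c$ is a sequence $\Lambda=(\lambda^{(1)},\ldots,\lambda^{(k)})$ of $k$ partitions such that $\lambda^{(i)}_j\ge\lambda^{(i+1)}_{j+c_{i+1}}$ for all $1\le i\le k-1$ and all $j\ge1$, and $\lambda^{(k)}_j\ge\lambda^{(1)}_{j+c_1}$ for all $j\ge1$. Set $|\Lambda|=\sum_{i}\sum_{j\ge1}\lambda^{(i)}_j$, $\max(\Lambda)=\max(\lambda^{(1)}_1,\ldots,\lambda^{(k)}_1)$, and $F_c(y,q)=\sum_\Lambda q^{|\Lambda|}y^{\max(\Lambda)}$, the sum over all cylindric partitions of profile $c$ (a formal power series in $y,q$). Let $I_c=\{i\in\{1,\ldots,k\}: c_i>0\}$. Indices are taken cyclically: index $0$ means $k$ (so $c_0=c_k$, and for $i=1$, "$i-1\in J$" means "$k\in J$"). For $J\subseteq I_c$, define the composition $c(J)=(c_1(J),\ldots,c_k(J))$ by $c_i(J)=c_i-1$ if $i\in J$ and $i-1\notin J$; $c_i(J)=c_i+1$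 if $i\notin J$ and $i-1\in J$; and $c_i(J)=c_i$ otherwise. -}

module Defs where

open import Data.Nat as ℕ using (ℕ; zero; suc; _+_; _*_; _∸_; _≤_; _<_; _≥_; _⊔_; _≤ᵇ_; _<ᵇ_; _≡ᵇ_)
open import Data.Nat.Properties using (_<?_)
open import Data.Integer as ℤ using (ℤ; +_; -[1+_])
open import Data.Bool using (Bool; true; false; if_then_else_; _∧_; _∨_; not)
open import Data.List as List using (List; []; _∷_; _++_)
open import Data.List.Relation.Unary.Linked using (Linked)
open import Data.List.Relation.Unary.All using (All)
open import Data.Vec as Vec using (Vec; lookup; tabulate; foldr)
open import Data.Fin as Fin using (Fin; toℕ; fromℕ<)
open import Data.Product using (Σ; _×_; _,_)
open import Data.Irrelevant using (Irrelevant)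
open import Relation.Nullary using (yes; no)
open import Relation.Binary.PropositionalEquality using (_≡_)

-- Partitions.  A partition λ = (λ₁, λ₂, …) (weakly decreasing, finitely
-- many nonzero terms) is represented canonically by the list of its
-- nonzero parts [λ₁, …, λₗ]; all later parts are 0.

record Partition : Set where
  constructor mkPartition
  field
    parts      : List ℕ
    .decreasing : Linked _≥_ parts
    .positive   : All (λ x → 0 < x) parts
open Partition public

-- part λ j  =  λ_{j+1}   (0-based index; 0 beyond the list)
partAt : List ℕ → ℕ → ℕ
partAt []       _       = 0
partAt (x ∷ xs) zero    = x
partAt (x ∷ xs) (suc j) = partAt xs j

part : Partition → ℕ → ℕ
part λp j = partAt (parts λp) j

weight : Partition → ℕ
weight λp = List.foldr _+_ 0 (parts λp)

-- Cyclic successor / predecessor on indices Fin k (paper index i ↔ Fin i-1)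

next : ∀ {k} → Fin k → Fin k
next {suc k} i with suc (toℕ i) <? suc k
... | yes p = fromℕ< p
... | no _  = Fin.zero

prev : ∀ {k} → Fin k → Fin k
prev {suc k} Fin.zero    = Fin.fromℕ k
prev {suc k} (Fin.suc i) = Fin.inject₁ i

-- λ^(i)_j ≥ λ^(i+1)_{j + c_{i+1}} for all i (cyclically, so that for the
-- last index this reads λ^(k)_j ≥ λ^(1)_{j + c_1}) and all j ≥ 1.
Cylindric : ∀ {k} → Vec ℕ k → Vec Partition k → Set
Cylindric c Λ = ∀ i (j : ℕ) →
  part (lookup Λ i) j ≥ part (lookup Λ (next i)) (j + lookup c (next i))

size : ∀ {k} → Vec Partition k → ℕ
size Λ = foldr _ (λ p s → weight p + s) 0 Λ

maxΛ : ∀ {k} → Vec Partition k → ℕ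
maxΛ Λ = foldr _ (λ p s → part p 0 ⊔ s) 0 Λ

CP : ∀ {k} → Vec ℕ k → ℕ → ℕ → Set
CP c m n = Σ (Vec Partition _) λ Λ →
  Irrelevant (Cylindric c Λ) × maxΛ Λ ≡ m × size Λ ≡ n

-- Formal power series in y, q with integer coefficients:
-- f m n is the coefficient of y^m q^n.

Series : Set
Series = ℕ → ℕ → ℤ

_≈ₛ_ : Series → Series → Set
f ≈ₛ g = ∀ m n → f m n ≡ g m n

Σ< : ℕ → (ℕ → ℤ) → ℤ
Σ< zero    f = + 0
Σ< (suc n) f = Σ< n f ℤ.+ f n

_+ₛ_ : Series → Series → Series
(f +ₛ g) m n = f m n ℤ.+ g m n

0ₛ : Series
0ₛ _ _ = + 0

_·ₛ_ : ℤ → Series → Series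
(a ·ₛ f) m n = a ℤ.* f m n

_*ₛ_ : Series → Series → Series
(f *ₛ g) m n = Σ< (suc m) λ a → Σ< (suc n) λ b → f a b ℤ.* g (m ∸ a) (n ∸ b)

-- f(y q^j, q) :  Σ f_{m,n} y^m q^{n + j m}
substYq : ℕ → Series → Series
substYq j f m N = if j * m ≤ᵇ N then f m (N ∸ j * m) else + 0

-- 1 / (1 - y q^j) = Σ_{t ≥ 0} y^t q^{j t}
geom : ℕ → Series
geom j m n = if n ≡ᵇ j * m then + 1 else + 0

Series1 : Set
Series1 = ℕ → ℤ

_≈₁_ : Series1 → Series1 → Set
f ≈₁ g = ∀ n → f n ≡ g n

one₁ : Series1
one₁ zero    = + 1
one₁ (suc _) = + 0

atY0 : Series → Series1
atY0 f n = f 0 n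

atQ0 : Series → Series1
atQ0 f m = f m 0

-- Generating function F_c(y,q) = Σ_Λ q^{|Λ|} y^{max Λ}, given the
-- coefficient function a with a c m n = #{Λ ∈ CP c m n}.

genF : ∀ {k} → (Vec ℕ k → ℕ → ℕ → ℕ) → Vec ℕ k → Series
genF a c m n = + a c m n

allSubsets : ∀ k → List (Vec Bool k)
allSubsets zero    = Vec.[] ∷ []
allSubsets (suc k) = List.map (true Vec.∷_) (allSubsets k)
                  ++ List.map (false Vec.∷_) (allSubsets k)

card : ∀ {k} → Vec Bool k → ℕ
card J = foldr _ (λ b s → (if b then 1 else 0) + s) 0 J

Ic : ∀ {k} → Vec ℕ k → Vec Bool k
Ic c = Vec.map (λ x → 0 <ᵇ x) c

subsetᵇ : ∀ {k} → Vec Bool k → Vec Bool k → Bool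
subsetᵇ J I = Vec.foldr _ _∧_ true (Vec.zipWith (λ a b → not a ∨ b) J I)

cJ : ∀ {k} → Vec ℕ k → Vec Bool k → Vec ℕ k
cJ c J = tabulate λ i →
  let inJ  = lookup J i
      pinJ = lookup J (prev i)
      ci   = lookup c i
  in if inJ ∧ not pinJ then ci ∸ 1
     else if not inJ ∧ pinJ then suc ci
     else ci

rhs : ∀ {k} → (Vec ℕ k → ℕ → ℕ → ℕ) → Vec ℕ k → Series
rhs {k} a c = List.foldr _+ₛ_ 0ₛ
  (List.map term
    (List.filter (λ J → Data.Bool.T? (subsetᵇ J (Ic c) ∧ (0 <ᵇ card J)))
                 (allSubsets k)))
  where
  open import Data.Bool
  term : Vec Bool k → Series
  term J = (ℤ.-1ℤ ℤ.^ (card J ∸ 1)) ·ₛ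
           (substYq (card J) (genF a (cJ c J)) *ₛ geom (card J))

-- Fix m and n, and call a row of Λ top if its first part equals max Λ = m. For J ⊆ I_c, deleting
-- the first part of every row in J is a bijection from the Λ ∈ CP(c, m, n) whose rows in J are
-- all top onto the cylindric partitions of profile c(J) with maximum ≤ m and weight n − |J| m,
-- and the latter are counted by the coefficient of y^m q^n in F_{c(J)}(y q^|J|, q) / (1 − y q^|J|).
-- So the right-hand side counts every Λ with weight Σ_{∅ ≠ J ⊆ top(Λ) ∩ I_c} (−1)^{|J|−1}, which is
-- 1 as soon as some top row i has c_i > 0. That is always the case: if the maximum sat only in
-- rows with c_i = 0, cylindricity would push it from row i to row i − 1 and so around the whole
-- cycle, forcing c = 0. Finally F_c(0, q) = F_c(y, 0) = 1 because the only cylindric partition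
-- with maximum 0, or with weight 0, is the empty one.

module Submission where

open import Defs
open import Data.Nat as ℕ
  using (ℕ; zero; suc; _+_; _*_; _∸_; _≤_; _<_; _≥_; _≤?_; _<?_; _≤ᵇ_; _<ᵇ_; _≡ᵇ_; z≤n; s≤s)
import Data.Nat.Properties as ℕ
open import Data.Nat.Tactic.RingSolver using (solve-∀)
open import Data.Integer as ℤ using (ℤ; +_; -1ℤ; _^_) renaming (_+_ to _+ℤ_; _*_ to _*ℤ_)
import Data.Integer.Properties as ℤ
open import Data.Bool using (Bool; true; false; T; if_then_else_; _∧_; not)
open import Data.Bool.Properties using (T-irrelevant; ∧-zeroʳ; T-∧; T-≡)
open import Data.Fin as Fin using (Fin; toℕ; fromℕ<; inject₁)
open import Data.Fin.Properties as FP using (+↔⊎; cantor-schröder-bernstein; toℕ-injective; any?)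
open import Data.Fin.Induction using (<-weakInduction; >-weakInduction)
open import Data.List as List using (List; []; _∷_; _++_)
open import Data.List.Properties using (map-++; map-∘)
open import Data.List.Relation.Unary.Linked as Linked using (Linked; []; [-]; _∷_)
open import Data.List.Relation.Unary.All as All using ([]; _∷_)
open import Data.Vec as Vec using (Vec; []; _∷_; lookup; sum)
open import Data.Vec.Properties using (lookup-map; lookup-zipWith; lookup∘tabulate; lookup-replicate)
open import Data.Product using (Σ; ∃; _×_; _,_; proj₁; proj₂)
open import Data.Product.Function.Dependent.Propositional using (Σ-↔)
open import Data.Sum using (_⊎_; inj₁; inj₂)
open import Data.Sum.Function.Propositional using (_⊎-↔_)
open import Data.Empty using (⊥; ⊥-elim)
open import Data.Unit using (tt)
open import Data.Irrelevant using ([_])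
open import Function using (_∘_; id)
open import Function.Bundles using (_↔_; Inverse; Injection; Equivalence; mk↔ₛ′)
open import Function.Properties.Inverse using (↔-refl; ↔-sym; ↔-trans; ↔⇒↣)
open import Relation.Nullary using (yes; no; ¬_)
open import Relation.Nullary.Decidable using (recompute; T?; _×-dec_)
open import Relation.Binary.PropositionalEquality

import Algebra.Properties.CommutativeMonoid.Sum as CommutativeMonoidSum
import Algebra.Properties.Semiring.Sum as SemiringSum

module ℕ∑ = CommutativeMonoidSum ℕ.+-0-commutativeMonoid
module ℤ∑ = SemiringSum ℤ.+-*-semiring
open ℤ∑ using (sum-syntax)

↔⇒≡ : ∀ {m n} → Fin m ↔ Fin n → m ≡ n
↔⇒≡ f = cantor-schröder-bernstein (Injection.injective (↔⇒↣ f)) (Injection.injective (↔⇒↣ (↔-sym f)))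

Σ-Fin-suc↔ : ∀ {n} (P : Fin (suc n) → Set) → Σ (Fin (suc n)) P ↔ (P Fin.zero ⊎ Σ (Fin n) (P ∘ Fin.suc))
Σ-Fin-suc↔ P = mk↔ₛ′
  (λ { (Fin.zero , p) → inj₁ p ; (Fin.suc i , p) → inj₂ (i , p) })
  (λ { (inj₁ p) → Fin.zero , p ; (inj₂ (i , p)) → Fin.suc i , p })
  (λ { (inj₁ p) → refl ; (inj₂ (i , p)) → refl })
  (λ { (Fin.zero , p) → refl ; (Fin.suc i , p) → refl })

Σ-Fin↔sum : ∀ {n} (g : Fin n → ℕ) → Σ (Fin n) (Fin ∘ g) ↔ Fin (ℕ∑.sum g)
Σ-Fin↔sum {zero}  g = mk↔ₛ′ (λ ()) (λ ()) (λ ()) (λ ())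
Σ-Fin↔sum {suc n} g =
  ↔-trans (Σ-Fin-suc↔ (Fin ∘ g)) (↔-trans (↔-refl ⊎-↔ Σ-Fin↔sum (g ∘ Fin.suc)) (↔-sym +↔⊎))

bit : Bool → ℕ
bit b = if b then 1 else 0

T↔Fin-bit : ∀ b → T b ↔ Fin (bit b)
T↔Fin-bit true  = mk↔ₛ′ (λ _ → Fin.zero) (λ _ → tt) (λ { Fin.zero → refl ; (Fin.suc ()) }) (λ _ → refl)
T↔Fin-bit false = mk↔ₛ′ (λ ()) (λ ()) (λ ()) (λ ())

Σ-T↔sum-bit : ∀ {n} (p : Fin n → Bool) → Σ (Fin n) (T ∘ p) ↔ Fin (ℕ∑.sum (bit ∘ p))
Σ-T↔sum-bit p = ↔-trans (Σ-↔ ↔-refl (T↔Fin-bit (p _))) (Σ-Fin↔sum (bit ∘ p))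

+-sum : ∀ {n} (g : Fin n → ℕ) → + ℕ∑.sum g ≡ ∑[ i < n ] (+ g i)
+-sum {zero}  g = refl
+-sum {suc n} g = trans (ℤ.pos-+ (g Fin.zero) _) (cong (λ s → + g Fin.zero +ℤ s) (+-sum (g ∘ Fin.suc)))

∑-one : ∀ N → ∑[ x < N ] (+ 1) ≡ + N
∑-one zero    = refl
∑-one (suc N) = cong (λ s → + 1 +ℤ s) (∑-one N)

↔-empty⇒≡0 : ∀ {N} {A : Set} → Fin N ↔ A → ¬ A → N ≡ 0
↔-empty⇒≡0 f ¬A = ↔⇒≡ (↔-trans f (mk↔ₛ′ (⊥-elim ∘ ¬A) (λ ()) (λ ()) (⊥-elim ∘ ¬A)))

sumℤ : List ℤ → ℤ
sumℤ = List.foldr _+ℤ_ (+ 0)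

sumℤ-++ : ∀ xs ys → sumℤ (xs ++ ys) ≡ sumℤ xs +ℤ sumℤ ys
sumℤ-++ []       ys = sym (ℤ.+-identityˡ (sumℤ ys))
sumℤ-++ (x ∷ xs) ys = trans (cong (x +ℤ_) (sumℤ-++ xs ys)) (sym (ℤ.+-assoc x (sumℤ xs) (sumℤ ys)))

sumℤ-map-cong : ∀ {A : Set} {f g : A → ℤ} → (∀ x → f x ≡ g x) → ∀ xs →
  sumℤ (List.map f xs) ≡ sumℤ (List.map g xs)
sumℤ-map-cong f≗g []       = refl
sumℤ-map-cong f≗g (x ∷ xs) = cong₂ _+ℤ_ (f≗g x) (sumℤ-map-cong f≗g xs)

sumℤ-map-zero : ∀ {A : Set} (xs : List A) → sumℤ (List.map (λ _ → + 0) xs) ≡ + 0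
sumℤ-map-zero []       = refl
sumℤ-map-zero (x ∷ xs) = trans (ℤ.+-identityˡ _) (sumℤ-map-zero xs)

sumℤ-map-*ˡ : ∀ {A : Set} c (f : A → ℤ) xs →
  sumℤ (List.map (λ x → c *ℤ f x) xs) ≡ c *ℤ sumℤ (List.map f xs)
sumℤ-map-*ˡ c f []       = sym (ℤ.*-zeroʳ c)
sumℤ-map-*ˡ c f (x ∷ xs) = trans (cong (c *ℤ f x +ℤ_) (sumℤ-map-*ˡ c f xs))
                                 (sym (ℤ.*-distribˡ-+ c (f x) _))

sumℤ-map-∑ : ∀ {A : Set} {n} (h : A → Fin n → ℤ) xs →
  sumℤ (List.map (λ x → ∑[ i < n ] h x i) xs) ≡ ∑[ i < n ] sumℤ (List.map (λ x → h x i) xs)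
sumℤ-map-∑ {n = n} h []       = sym (ℤ∑.sum-replicate-zero n)
sumℤ-map-∑         h (x ∷ xs) = trans (cong (ℤ∑.sum (h x) +ℤ_) (sumℤ-map-∑ h xs))
                                      (sym (ℤ∑.∑-distrib-+ (h x) _))

sumℤ-filter : ∀ {A : Set} (P : A → Bool) (g : A → ℤ) xs →
  sumℤ (List.map g (List.filter (T? ∘ P) xs)) ≡ sumℤ (List.map (λ x → if P x then g x else + 0) xs)
sumℤ-filter P g [] = refl
sumℤ-filter P g (x ∷ xs) with P x
... | true  = cong (g x +ℤ_) (sumℤ-filter P g xs)
... | false = trans (sumℤ-filter P g xs) (sym (ℤ.+-identityˡ _))

foldr-+ₛ-apply : ∀ {A : Set} (t : A → Series) xs m n →
  List.foldr _+ₛ_ 0ₛ (List.map t xs) m n ≡ sumℤ (List.map (λ x → t x m n) xs)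
foldr-+ₛ-apply t []       m n = refl
foldr-+ₛ-apply t (x ∷ xs) m n = cong (t x m n +ℤ_) (foldr-+ₛ-apply t xs m n)

sumℤ-allSubsets-suc : ∀ {k} (f : Vec Bool (suc k) → ℤ) →
  sumℤ (List.map f (allSubsets (suc k))) ≡
  sumℤ (List.map (f ∘ (true ∷_)) (allSubsets k)) +ℤ sumℤ (List.map (f ∘ (false ∷_)) (allSubsets k))
sumℤ-allSubsets-suc {k} f = begin
  sumℤ (List.map f (List.map (true ∷_) A ++ List.map (false ∷_) A))
    ≡⟨ cong sumℤ (map-++ f (List.map (true ∷_) A) _) ⟩
  sumℤ (List.map f (List.map (true ∷_) A) ++ List.map f (List.map (false ∷_) A))
    ≡⟨ sumℤ-++ (List.map f (List.map (true ∷_) A)) _ ⟩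
  sumℤ (List.map f (List.map (true ∷_) A)) +ℤ sumℤ (List.map f (List.map (false ∷_) A))
    ≡⟨ cong₂ _+ℤ_ (cong sumℤ (map-∘ A)) (cong sumℤ (map-∘ A)) ⟨
  sumℤ (List.map (f ∘ (true ∷_)) A) +ℤ sumℤ (List.map (f ∘ (false ∷_)) A) ∎
  where
  open ≡-Reasoning
  A = allSubsets k

-- Coefficient extraction

if-true : ∀ {A : Set} {b} {x y : A} → T b → (if b then x else y) ≡ x
if-true {b = true} _ = refl

if-false : ∀ {A : Set} {b} {x y : A} → ¬ T b → (if b then x else y) ≡ y
if-false {b = true}  ¬t = ⊥-elim (¬t tt)
if-false {b = false} _  = refl

Σ<-zero : ∀ N {f : ℕ → ℤ} → (∀ x → x < N → f x ≡ + 0) → Σ< N f ≡ + 0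
Σ<-zero zero    _ = refl
Σ<-zero (suc N) h = cong₂ _+ℤ_ (Σ<-zero N (λ x x<N → h x (ℕ.m<n⇒m<1+n x<N))) (h N ℕ.≤-refl)

Σ<-cong : ∀ N {f g : ℕ → ℤ} → (∀ x → x < N → f x ≡ g x) → Σ< N f ≡ Σ< N g
Σ<-cong zero    _ = refl
Σ<-cong (suc N) h = cong₂ _+ℤ_ (Σ<-cong N (λ x x<N → h x (ℕ.m<n⇒m<1+n x<N))) (h N ℕ.≤-refl)

Σ<-single : ∀ N (f : ℕ → ℤ) j → j < N → (∀ x → x < N → x ≢ j → f x ≡ + 0) → Σ< N f ≡ f j
Σ<-single (suc N) f j j<1+N h with j ℕ.≟ N
... | yes refl = trans (cong (_+ℤ f j) (Σ<-zero N (λ x x<N → h x (ℕ.m<n⇒m<1+n x<N) (ℕ.<⇒≢ x<N))))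
                       (ℤ.+-identityˡ (f j))
... | no j≢N = trans (cong₂ _+ℤ_ (Σ<-single N f j (ℕ.≤∧≢⇒< (ℕ.≤-pred j<1+N) j≢N)
                                     (λ x x<N → h x (ℕ.m<n⇒m<1+n x<N)))
                                  (h N ℕ.≤-refl (j≢N ∘ sym)))
                     (ℤ.+-identityʳ (f j))

Σ<-if : ∀ N b (g : ℕ → ℤ) → Σ< N (λ x → if b then g x else + 0) ≡ (if b then Σ< N g else + 0)
Σ<-if N true  g = refl
Σ<-if N false g = Σ<-zero N (λ _ _ → refl)

Σ<-suc : ∀ N (f : ℕ → ℤ) → Σ< (suc N) f ≡ f 0 +ℤ Σ< N (f ∘ suc)
Σ<-suc zero    f = trans (ℤ.+-identityˡ (f 0)) (sym (ℤ.+-identityʳ (f 0)))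
Σ<-suc (suc N) f = trans (cong (_+ℤ f (suc N)) (Σ<-suc N f)) (ℤ.+-assoc (f 0) _ _)

Σ<≡∑ : ∀ N (f : ℕ → ℤ) → Σ< N f ≡ ∑[ i < N ] f (toℕ i)
Σ<≡∑ zero    f = refl
Σ<≡∑ (suc N) f = trans (Σ<-suc N f) (cong (λ s → f 0 +ℤ s) (Σ<≡∑ N (f ∘ suc)))

geom-diagonal : ∀ r M → geom r M (r * M) ≡ + 1
geom-diagonal r M = if-true (ℕ.≡⇒≡ᵇ (r * M) (r * M) refl)

geom-off-diagonal : ∀ r M x → x ≢ r * M → geom r M x ≡ + 0
geom-off-diagonal r M x x≢rM = if-false (x≢rM ∘ ℕ.≡ᵇ⇒≡ x (r * M))

Σ<-*-geom : ∀ r M n (G : ℕ → ℤ) →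
  Σ< (suc n) (λ b → G b *ℤ geom r M (n ∸ b)) ≡ (if r * M ≤ᵇ n then G (n ∸ r * M) else + 0)
Σ<-*-geom r M n G with r * M ≤? n
... | yes K≤n = begin
  Σ< (suc n) (λ b → G b *ℤ geom r M (n ∸ b))   ≡⟨ Σ<-single (suc n) _ (n ∸ K) (s≤s (ℕ.m∸n≤m n K)) off ⟩
  G (n ∸ K) *ℤ geom r M (n ∸ (n ∸ K))          ≡⟨ cong (λ x → G (n ∸ K) *ℤ geom r M x) (ℕ.m∸[m∸n]≡n K≤n) ⟩
  G (n ∸ K) *ℤ geom r M K                      ≡⟨ cong (G (n ∸ K) *ℤ_) (geom-diagonal r M) ⟩
  G (n ∸ K) *ℤ + 1                             ≡⟨ ℤ.*-identityʳ _ ⟩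
  G (n ∸ K)                                    ≡⟨ if-true (ℕ.≤⇒≤ᵇ K≤n) ⟨
  (if K ≤ᵇ n then G (n ∸ K) else + 0)          ∎
  where
  open ≡-Reasoning
  K = r * M
  off : ∀ b → b < suc n → b ≢ n ∸ K → G b *ℤ geom r M (n ∸ b) ≡ + 0
  off b b≤n b≢ = trans (cong (G b *ℤ_) (geom-off-diagonal r M (n ∸ b)
                          (λ e → b≢ (trans (sym (ℕ.m∸[m∸n]≡n (ℕ.≤-pred b≤n))) (cong (n ∸_) e)))))
                       (ℤ.*-zeroʳ (G b))
... | no K≰n = trans (Σ<-zero (suc n) off) (sym (if-false (K≰n ∘ ℕ.≤ᵇ⇒≤ (r * M) n)))
  where
  off : ∀ b → b < suc n → G b *ℤ geom r M (n ∸ b) ≡ + 0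
  off b _ = trans (cong (G b *ℤ_) (geom-off-diagonal r M (n ∸ b)
                     (λ e → K≰n (subst (_≤ n) e (ℕ.m∸n≤m n b)))))
                  (ℤ.*-zeroʳ (G b))

*-∸-split : ∀ r {a m} → a ≤ m → r * m ≡ r * a + r * (m ∸ a)
*-∸-split r {a} {m} a≤m = trans (cong (r *_) (sym (ℕ.m+[n∸m]≡n a≤m))) (ℕ.*-distribˡ-+ r a (m ∸ a))

substYq-shift : ∀ r F {a m} n → a ≤ m →
  (if r * (m ∸ a) ≤ᵇ n then substYq r F a (n ∸ r * (m ∸ a)) else + 0) ≡
  (if r * m ≤ᵇ n then F a (n ∸ r * m) else + 0)
substYq-shift r F {a} {m} n a≤m with r * m ≤? n
... | yes rm≤n = begin
  (if K ≤ᵇ n then substYq r F a (n ∸ K) else + 0)  ≡⟨ if-true (ℕ.≤⇒≤ᵇ (ℕ.≤-trans K≤rm rm≤n)) ⟩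
  substYq r F a (n ∸ K)                            ≡⟨ if-true (ℕ.≤⇒≤ᵇ ra≤n∸K) ⟩
  F a (n ∸ K ∸ r * a)                              ≡⟨ cong (F a) (ℕ.∸-+-assoc n K (r * a)) ⟩
  F a (n ∸ (K + r * a))                            ≡⟨ cong (λ x → F a (n ∸ x)) (trans (ℕ.+-comm K (r * a)) (sym rm≡)) ⟩
  F a (n ∸ r * m)                                  ≡⟨ if-true (ℕ.≤⇒≤ᵇ rm≤n) ⟨
  (if r * m ≤ᵇ n then F a (n ∸ r * m) else + 0)    ∎
  where
  open ≡-Reasoning
  K = r * (m ∸ a)
  rm≡ : r * m ≡ r * a + K
  rm≡ = *-∸-split r a≤m
  K≤rm : K ≤ r * m
  K≤rm = ℕ.*-monoʳ-≤ r (ℕ.m∸n≤m m a)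
  ra≤n∸K : r * a ≤ n ∸ K
  ra≤n∸K = ℕ.m+n≤o⇒m≤o∸n (r * a) (subst (_≤ n) rm≡ rm≤n)
... | no rm≰n = trans lhs≡0 (sym (if-false (rm≰n ∘ ℕ.≤ᵇ⇒≤ (r * m) n)))
  where
  K = r * (m ∸ a)
  lhs≡0 : (if K ≤ᵇ n then substYq r F a (n ∸ K) else + 0) ≡ + 0
  lhs≡0 with K ≤? n
  ... | no K≰n  = if-false (K≰n ∘ ℕ.≤ᵇ⇒≤ K n)
  ... | yes K≤n = trans (if-true (ℕ.≤⇒≤ᵇ K≤n)) (if-false λ t → rm≰n
        (subst (_≤ n) (sym (*-∸-split r a≤m))
        (ℕ.m≤o∸n⇒m+n≤o (r * a) K≤n (ℕ.≤ᵇ⇒≤ (r * a) (n ∸ K) t))))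

coeff-substYq-*-geom : ∀ r F m n →
  (substYq r F *ₛ geom r) m n ≡ (if r * m ≤ᵇ n then Σ< (suc m) (λ a → F a (n ∸ r * m)) else + 0)
coeff-substYq-*-geom r F m n =
  trans (Σ<-cong (suc m) (λ a a≤m → trans (Σ<-*-geom r (m ∸ a) n (substYq r F a))
                                          (substYq-shift r F n (ℕ.≤-pred a≤m))))
        (Σ<-if (suc m) (r * m ≤ᵇ n) (λ a → F a (n ∸ r * m)))

-- Inclusion–exclusion over subsets

subsetSign : ∀ {k} → Vec Bool k → Vec Bool k → ℤ
subsetSign S J = if subsetᵇ J S then -1ℤ ^ card J else + 0

nonemptySubsetSign : ∀ {k} → Vec Bool k → Vec Bool k → ℤ
nonemptySubsetSign S J = if subsetᵇ J S ∧ (0 <ᵇ card J) then -1ℤ ^ (card J ∸ 1) else + 0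

subsetSign-∷-true : ∀ {k} (S J : Vec Bool k) → subsetSign (true ∷ S) (true ∷ J) ≡ -1ℤ *ℤ subsetSign S J
subsetSign-∷-true S J with subsetᵇ J S
... | true  = refl
... | false = refl

nonemptySubsetSign-∷-true : ∀ {k} (S J : Vec Bool k) →
  nonemptySubsetSign (true ∷ S) (true ∷ J) ≡ subsetSign S J
nonemptySubsetSign-∷-true S J with subsetᵇ J S
... | true  = refl
... | false = refl

∑-subsetSign : ∀ {k} (S : Vec Bool k) →
  sumℤ (List.map (subsetSign S) (allSubsets k)) ≡ + bit (card S ≡ᵇ 0)
∑-subsetSign [] = refl
∑-subsetSign {suc k} (true ∷ S) = begin
  sumℤ (List.map (subsetSign (true ∷ S)) (allSubsets (suc k)))
    ≡⟨ sumℤ-allSubsets-suc (subsetSign (true ∷ S)) ⟩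
  sumℤ (List.map (subsetSign (true ∷ S) ∘ (true ∷_)) A) +ℤ σ
    ≡⟨ cong (_+ℤ σ) (trans (sumℤ-map-cong (subsetSign-∷-true S) A) (sumℤ-map-*ˡ -1ℤ (subsetSign S) A)) ⟩
  -1ℤ *ℤ σ +ℤ σ
    ≡⟨ cong (_+ℤ σ) (ℤ.-1*i≡-i σ) ⟩
  ℤ.- σ +ℤ σ
    ≡⟨ ℤ.+-inverseˡ σ ⟩
  + 0 ∎
  where
  open ≡-Reasoning
  A = allSubsets k
  σ = sumℤ (List.map (subsetSign S) A)
∑-subsetSign {suc k} (false ∷ S) =
  trans (sumℤ-allSubsets-suc (subsetSign (false ∷ S)))
        (trans (cong (_+ℤ sumℤ (List.map (subsetSign S) (allSubsets k))) (sumℤ-map-zero (allSubsets k)))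
               (trans (ℤ.+-identityˡ _) (∑-subsetSign S)))

∑-nonemptySubsetSign : ∀ {k} (S : Vec Bool k) →
  sumℤ (List.map (nonemptySubsetSign S) (allSubsets k)) ≡ + bit (0 <ᵇ card S)
∑-nonemptySubsetSign [] = refl
∑-nonemptySubsetSign {suc k} (true ∷ S) =
  trans (sumℤ-allSubsets-suc (nonemptySubsetSign (true ∷ S)))
        (trans (cong₂ _+ℤ_ (trans (sumℤ-map-cong (nonemptySubsetSign-∷-true S) (allSubsets k)) (∑-subsetSign S))
                           (∑-nonemptySubsetSign S))
               (empty+nonempty (card S)))
  where
  empty+nonempty : ∀ n → + bit (n ≡ᵇ 0) +ℤ + bit (0 <ᵇ n) ≡ + 1
  empty+nonempty zero    = refl
  empty+nonempty (suc n) = refl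
∑-nonemptySubsetSign {suc k} (false ∷ S) =
  trans (sumℤ-allSubsets-suc (nonemptySubsetSign (false ∷ S)))
        (trans (cong (_+ℤ sumℤ (List.map (nonemptySubsetSign S) (allSubsets k))) (sumℤ-map-zero (allSubsets k)))
               (trans (ℤ.+-identityˡ _) (∑-nonemptySubsetSign S)))

subsetᵇ-∧ : ∀ {k} (J I S : Vec Bool k) → subsetᵇ J (Vec.zipWith _∧_ I S) ≡ subsetᵇ J I ∧ subsetᵇ J S
subsetᵇ-∧ []          []          []          = refl
subsetᵇ-∧ (false ∷ J) (_     ∷ I) (_     ∷ S) = subsetᵇ-∧ J I S
subsetᵇ-∧ (true  ∷ J) (true  ∷ I) (true  ∷ S) = subsetᵇ-∧ J I S
subsetᵇ-∧ (true  ∷ J) (true  ∷ I) (false ∷ S) = sym (∧-zeroʳ (subsetᵇ J I))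
subsetᵇ-∧ (true  ∷ J) (false ∷ I) (_     ∷ S) = refl

nonemptySubsetSign-∧ : ∀ {k} (I S J : Vec Bool k) →
  nonemptySubsetSign (Vec.zipWith _∧_ I S) J ≡
  (if subsetᵇ J I ∧ (0 <ᵇ card J) then -1ℤ ^ (card J ∸ 1) *ℤ + bit (subsetᵇ J S) else + 0)
nonemptySubsetSign-∧ I S J =
  trans (cong (λ b → if b ∧ (0 <ᵇ card J) then -1ℤ ^ (card J ∸ 1) else + 0) (subsetᵇ-∧ J I S))
        (select (subsetᵇ J I) (subsetᵇ J S) (0 <ᵇ card J))
  where
  select : ∀ a b z {s} → (if (a ∧ b) ∧ z then s else + 0) ≡ (if a ∧ z then s *ℤ + bit b else + 0)
  select false _     _     = refl
  select true  true  z {s} = cong (λ x → if z then x else + 0) (sym (ℤ.*-identityʳ s))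
  select true  false false = refl
  select true  false true {s} = sym (ℤ.*-zeroʳ s)

member⇒card-pos : ∀ {k} (S : Vec Bool k) i → T (lookup S i) → 0 < card S
member⇒card-pos (true ∷ S) Fin.zero    _   = s≤s z≤n
member⇒card-pos (b    ∷ S) (Fin.suc i) i∈S = ℕ.≤-trans (member⇒card-pos S i i∈S) (ℕ.m≤n+m (card S) (bit b))

card-pos⇒member : ∀ {k} (S : Vec Bool k) → 0 < card S → ∃ λ i → T (lookup S i)
card-pos⇒member (true  ∷ S) _      = Fin.zero , tt
card-pos⇒member (false ∷ S) 0<|S| = let i , i∈S = card-pos⇒member S 0<|S| in Fin.suc i , i∈S

subsetᵇ-sound : ∀ {k} (J V : Vec Bool k) → T (subsetᵇ J V) → ∀ i → T (lookup J i) → T (lookup V i)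
subsetᵇ-sound (true  ∷ J) (true ∷ V) J⊆V Fin.zero    _   = tt
subsetᵇ-sound (true  ∷ J) (true ∷ V) J⊆V (Fin.suc i) i∈J = subsetᵇ-sound J V J⊆V i i∈J
subsetᵇ-sound (false ∷ J) (v    ∷ V) J⊆V (Fin.suc i) i∈J = subsetᵇ-sound J V J⊆V i i∈J

subsetᵇ-complete : ∀ {k} (J V : Vec Bool k) → (∀ i → T (lookup J i) → T (lookup V i)) → T (subsetᵇ J V)
subsetᵇ-complete []          []       _   = tt
subsetᵇ-complete (true  ∷ J) (v ∷ V) J⊆V with J⊆V Fin.zero tt
subsetᵇ-complete (true  ∷ J) (true ∷ V) J⊆V | _ = subsetᵇ-complete J V (J⊆V ∘ Fin.suc)
subsetᵇ-complete (false ∷ J) (v ∷ V) J⊆V = subsetᵇ-complete J V (J⊆V ∘ Fin.suc)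

Partition-≡ : ∀ {p q : Partition} → parts p ≡ parts q → p ≡ q
Partition-≡ {mkPartition ps _ _} {mkPartition .ps _ _} refl = refl

firstPart : Partition → ℕ
firstPart p = part p 0

partAt≤head : ∀ {ps} → Linked _≥_ ps → ∀ j → partAt ps j ≤ partAt ps 0
partAt≤head []        _       = z≤n
partAt≤head [-]       zero    = ℕ.≤-refl
partAt≤head [-]       (suc j) = z≤n
partAt≤head (_ ∷ _)   zero    = ℕ.≤-refl
partAt≤head (x≥y ∷ l) (suc j) = ℕ.≤-trans (partAt≤head l j) x≥y

part≤firstPart : ∀ p j → part p j ≤ firstPart p
part≤firstPart p@(mkPartition _ d _) j = recompute (part p j ≤? firstPart p) (partAt≤head d j)

head-positive : ∀ {x xs} → .(All.All (0 <_) (x ∷ xs)) → 0 < x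
head-positive {x} pos = recompute (0 <? x) (All.head pos)

firstPart≡0⇒parts≡[] : ∀ p → firstPart p ≡ 0 → parts p ≡ []
firstPart≡0⇒parts≡[] (mkPartition []       _ _)       _  = refl
firstPart≡0⇒parts≡[] (mkPartition (x ∷ xs) _ pos) x≡0 = ⊥-elim (ℕ.<-irrefl (sym x≡0) (head-positive pos))

firstPart≡0⇒part≡0 : ∀ p → firstPart p ≡ 0 → ∀ j → part p j ≡ 0
firstPart≡0⇒part≡0 p p₁≡0 j = ℕ.n≤0⇒n≡0 (subst (part p j ≤_) p₁≡0 (part≤firstPart p j))

dropFirst : Partition → Partition
dropFirst (mkPartition []       d a) = mkPartition [] d a
dropFirst (mkPartition (x ∷ xs) d a) = mkPartition xs (Linked.tail d) (All.tail a)

part-dropFirst : ∀ p j → part (dropFirst p) j ≡ part p (suc j)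
part-dropFirst (mkPartition []      _ _) j = refl
part-dropFirst (mkPartition (_ ∷ _) _ _) j = refl

weight-dropFirst : ∀ p → weight p ≡ firstPart p + weight (dropFirst p)
weight-dropFirst (mkPartition []      _ _) = refl
weight-dropFirst (mkPartition (_ ∷ _) _ _) = refl

∷-decreasing : ∀ {x} xs → partAt xs 0 ≤ x → Linked _≥_ xs → Linked _≥_ (x ∷ xs)
∷-decreasing []      _   _ = [-]
∷-decreasing (_ ∷ _) y≤x l = y≤x ∷ l

-- Junk values: prepend m p = p when m < firstPart p, and prepend 0 p = p (a part 0 would break
-- positivity; under firstPart p ≤ 0 this is still the intended result, as p is then empty).
prepend : ℕ → Partition → Partition
prepend zero    p = p
prepend (suc m) p@(mkPartition ps d a) with partAt ps 0 ≤? suc m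
... | yes p₁≤m = mkPartition (suc m ∷ ps) (∷-decreasing ps p₁≤m d) (s≤s z≤n ∷ a)
... | no  _    = p

consIf : Bool → ℕ → (ℕ → ℕ) → ℕ → ℕ
consIf false m f j       = f j
consIf true  m f zero    = m
consIf true  m f (suc j) = f j

part-prepend : ∀ m p → firstPart p ≤ m → ∀ j → part (prepend m p) j ≡ consIf true m (part p) j
part-prepend zero    p p₁≤0 zero    = firstPart≡0⇒part≡0 p (ℕ.n≤0⇒n≡0 p₁≤0) 0
part-prepend zero    p p₁≤0 (suc j) =
  trans (firstPart≡0⇒part≡0 p p₁≡0 (suc j)) (sym (firstPart≡0⇒part≡0 p p₁≡0 j))
  where p₁≡0 = ℕ.n≤0⇒n≡0 p₁≤0
part-prepend (suc m) p p₁≤m j with firstPart p ≤? suc m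
part-prepend (suc m) p p₁≤m zero    | yes _ = refl
part-prepend (suc m) p p₁≤m (suc j) | yes _ = refl
... | no p₁≰m = ⊥-elim (p₁≰m p₁≤m)

dropFirst-prepend : ∀ m p → firstPart p ≤ m → dropFirst (prepend m p) ≡ p
dropFirst-prepend zero (mkPartition []       _ _)   _    = refl
dropFirst-prepend zero (mkPartition (x ∷ xs) _ pos) x≤0 = ⊥-elim (ℕ.<⇒≱ (head-positive pos) x≤0)
dropFirst-prepend (suc m) p p₁≤m with firstPart p ≤? suc m
... | yes _    = Partition-≡ refl
... | no p₁≰m = ⊥-elim (p₁≰m p₁≤m)

prepend-dropFirst : ∀ p → prepend (firstPart p) (dropFirst p) ≡ p
prepend-dropFirst (mkPartition []       _ _) = refl
prepend-dropFirst (mkPartition (zero  ∷ xs) _ pos) = ⊥-elim (ℕ.<-irrefl refl (head-positive pos))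
prepend-dropFirst p@(mkPartition (suc x ∷ xs) _ _) with firstPart (dropFirst p) ≤? suc x
... | yes _    = Partition-≡ refl
... | no y≰x  = ⊥-elim (y≰x (subst (_≤ suc x) (sym (part-dropFirst p 0)) (part≤firstPart p 1)))

emptyPartition : Partition
emptyPartition = mkPartition [] [] []

-- Cylindric partitions

prev-next : ∀ {k} (i : Fin k) → prev (next i) ≡ i
prev-next {suc k} i with suc (toℕ i) <? suc k
... | yes i+1<1+k = toℕ-injective (trans (FP.toℕ-inject₁ (fromℕ< (ℕ.≤-pred i+1<1+k)))
                                         (FP.toℕ-fromℕ< (ℕ.≤-pred i+1<1+k)))
... | no  i+1≮1+k = toℕ-injective (trans (FP.toℕ-fromℕ k)
                      (ℕ.≤-antisym (ℕ.≮⇒≥ (i+1≮1+k ∘ s≤s)) (ℕ.≤-pred (FP.toℕ<n i))))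

next-prev : ∀ {k} (i : Fin k) → next (prev i) ≡ i
next-prev {suc k} Fin.zero with suc (toℕ (Fin.fromℕ k)) <? suc k
... | yes k+1<1+k = ⊥-elim (ℕ.<-irrefl (FP.toℕ-fromℕ k) (ℕ.≤-pred k+1<1+k))
... | no  _       = refl
next-prev {suc k} (Fin.suc i) with suc (toℕ (inject₁ i)) <? suc k
... | yes i+1<1+k = toℕ-injective (trans (FP.toℕ-fromℕ< i+1<1+k) (cong suc (FP.toℕ-inject₁ i)))
... | no  i+1≮1+k = ⊥-elim (i+1≮1+k (s≤s (subst (_< k) (sym (FP.toℕ-inject₁ i)) (FP.toℕ<n i))))

prev-closed⇒all : ∀ {k} (P : Fin (suc k) → Set) → (∀ i → P i → P (prev i)) →
  ∀ {i} → P i → ∀ j → P j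
prev-closed⇒all P closed {i} Pi = >-weakInduction P (closed Fin.zero (reach-zero i Pi)) (closed ∘ Fin.suc)
  where
  reach-zero : ∀ i → P i → P Fin.zero
  reach-zero = <-weakInduction (λ i → P i → P Fin.zero) id (λ i Pi⇒P0 → Pi⇒P0 ∘ closed (Fin.suc i))

_⊆-positive_ : ∀ {k} → Vec Bool k → Vec ℕ k → Set
J ⊆-positive c = ∀ i → T (lookup J i) → 0 < lookup c i

cJ-balance : ∀ {k} (c : Vec ℕ k) J → J ⊆-positive c → ∀ i →
  lookup (cJ c J) i + bit (lookup J i) ≡ bit (lookup J (prev i)) + lookup c i
cJ-balance c J J⊆c i =
  trans (cong (_+ bit (lookup J i)) (lookup∘tabulate _ i)) (balance (lookup J i) (lookup J (prev i)) (J⊆c i))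
  where
  balance : ∀ b a {x} → (T b → 0 < x) →
    (if b ∧ not a then x ∸ 1 else if not b ∧ a then suc x else x) + bit b ≡ bit a + x
  balance false false {x}     _   = ℕ.+-identityʳ x
  balance false true  {x}     _   = cong suc (ℕ.+-identityʳ x)
  balance true  true  {x}     _   = ℕ.+-comm x 1
  balance true  false {suc x} _   = ℕ.+-comm x 1
  balance true  false {zero}  x>0 with () ← x>0 tt

cJ-balance-next : ∀ {k} (c : Vec ℕ k) J → J ⊆-positive c → ∀ i →
  lookup (cJ c J) (next i) + bit (lookup J (next i)) ≡ bit (lookup J i) + lookup c (next i)
cJ-balance-next c J J⊆c i =
  trans (cJ-balance c J J⊆c (next i)) (cong (λ x → bit (lookup J x) + lookup c (next i)) (prev-next i))

dropFirstIf : Bool → Partition → Partition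
dropFirstIf true  = dropFirst
dropFirstIf false = id

prependIf : Bool → ℕ → Partition → Partition
prependIf true  = prepend
prependIf false _ = id

part-dropFirstIf : ∀ b p j → part (dropFirstIf b p) j ≡ part p (bit b + j)
part-dropFirstIf true  p j = part-dropFirst p j
part-dropFirstIf false p j = refl

part-prependIf : ∀ b m p → firstPart p ≤ m → ∀ j → part (prependIf b m p) j ≡ consIf b m (part p) j
part-prependIf true  m p p₁≤m j = part-prepend m p p₁≤m j
part-prependIf false m p p₁≤m j = refl

consIf-≤ : ∀ b m (f : ℕ → ℕ) → (∀ j → f j ≤ m) → ∀ j → consIf b m f j ≤ m
consIf-≤ false m f f≤m j       = f≤m j
consIf-≤ true  m f f≤m zero    = ℕ.≤-refl
consIf-≤ true  m f f≤m (suc j) = f≤m j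

-- In both lemmas a, b are the flags of two consecutive rows and c, c' the old and new offsets
-- between them, so that c' + [b] = [a] + c is cJ-balance.
dropIf-cylindric : ∀ a b {c c'} (P Q : ℕ → ℕ) → c' + bit b ≡ bit a + c →
  (∀ j → Q (j + c) ≤ P j) → ∀ j → Q (bit b + (j + c')) ≤ P (bit a + j)
dropIf-cylindric a b {c} {c'} P Q balanced cyl j = subst (λ x → Q x ≤ P (bit a + j)) (sym index) (cyl (bit a + j))
  where
  open ≡-Reasoning
  index : bit b + (j + c') ≡ (bit a + j) + c
  index = begin
    bit b + (j + c') ≡⟨ ℕ.+-comm (bit b) (j + c') ⟩
    (j + c') + bit b ≡⟨ ℕ.+-assoc j c' (bit b) ⟩
    j + (c' + bit b) ≡⟨ cong (λ x → j + x) balanced ⟩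
    j + (bit a + c)  ≡⟨ ℕ.+-assoc j (bit a) c ⟨
    (j + bit a) + c  ≡⟨ cong (_+ c) (ℕ.+-comm j (bit a)) ⟩
    (bit a + j) + c  ∎

consIf-cylindric : ∀ a b {c c'} m (P Q : ℕ → ℕ) → c' + bit b ≡ bit a + c →
  (∀ j → Q (j + c') ≤ P j) → (∀ j → Q j ≤ m) → ∀ j → consIf b m Q (j + c) ≤ consIf a m P j
consIf-cylindric true  b {c} m P Q _ _ Q≤m zero = consIf-≤ b m Q Q≤m c
consIf-cylindric true  true  {c} {c'} m P Q balanced cyl _ (suc j) =
  subst (λ x → Q (j + x) ≤ P j) (ℕ.suc-injective (trans (ℕ.+-comm 1 c') balanced)) (cyl j)
consIf-cylindric true  false {c} {c'} m P Q balanced cyl _ (suc j) =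
  subst (λ x → Q x ≤ P j)
        (trans (cong (λ x → j + x) (trans (sym (ℕ.+-identityʳ c')) balanced)) (ℕ.+-suc j c)) (cyl j)
consIf-cylindric false true  {c} {c'} m P Q balanced cyl _ j =
  subst (λ x → consIf true m Q x ≤ P j)
        (sym (trans (cong (λ x → j + x) (trans (sym balanced) (ℕ.+-comm c' 1))) (ℕ.+-suc j c'))) (cyl j)
consIf-cylindric false false {c} {c'} m P Q balanced cyl _ j =
  subst (λ x → Q (j + x) ≤ P j) (trans (sym (ℕ.+-identityʳ c')) balanced) (cyl j)

removeRows : ∀ {k} → Vec Bool k → Vec Partition k → Vec Partition k
removeRows = Vec.zipWith dropFirstIf

addRows : ∀ {k} → ℕ → Vec Bool k → Vec Partition k → Vec Partition k
addRows m = Vec.zipWith (λ b → prependIf b m)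

FirstParts≤ : ∀ {k} → ℕ → Vec Partition k → Set
FirstParts≤ m Λ = ∀ i → firstPart (lookup Λ i) ≤ m

FirstParts≡On : ∀ {k} → Vec Bool k → ℕ → Vec Partition k → Set
FirstParts≡On J m Λ = ∀ i → T (lookup J i) → firstPart (lookup Λ i) ≡ m

part-removeRows : ∀ {k} J (Λ : Vec Partition k) i j →
  part (lookup (removeRows J Λ) i) j ≡ part (lookup Λ i) (bit (lookup J i) + j)
part-removeRows J Λ i j =
  trans (cong (λ p → part p j) (lookup-zipWith dropFirstIf i J Λ)) (part-dropFirstIf (lookup J i) (lookup Λ i) j)

part-addRows : ∀ {k} m J (Λ : Vec Partition k) → FirstParts≤ m Λ → ∀ i j →
  part (lookup (addRows m J Λ) i) j ≡ consIf (lookup J i) m (part (lookup Λ i)) j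
part-addRows m J Λ Λ≤m i j =
  trans (cong (λ p → part p j) (lookup-zipWith (λ b → prependIf b m) i J Λ))
        (part-prependIf (lookup J i) m (lookup Λ i) (Λ≤m i) j)

removeRows-cylindric : ∀ {k} (c : Vec ℕ k) J Λ → J ⊆-positive c →
  Cylindric c Λ → Cylindric (cJ c J) (removeRows J Λ)
removeRows-cylindric c J Λ J⊆c cyl i j =
  subst₂ _≥_ (sym (part-removeRows J Λ i j)) (sym (part-removeRows J Λ (next i) _))
    (dropIf-cylindric (lookup J i) (lookup J (next i)) (part (lookup Λ i)) (part (lookup Λ (next i)))
      (cJ-balance-next c J J⊆c i) (cyl i) j)

addRows-cylindric : ∀ {k} (c : Vec ℕ k) J m Λ → J ⊆-positive c → FirstParts≤ m Λ →
  Cylindric (cJ c J) Λ → Cylindric c (addRows m J Λ)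
addRows-cylindric c J m Λ J⊆c Λ≤m cyl i j =
  subst₂ _≥_ (sym (part-addRows m J Λ Λ≤m i j)) (sym (part-addRows m J Λ Λ≤m (next i) _))
    (consIf-cylindric (lookup J i) (lookup J (next i)) m (part (lookup Λ i)) (part (lookup Λ (next i)))
      (cJ-balance-next c J J⊆c i) (cyl i)
      (λ x → ℕ.≤-trans (part≤firstPart (lookup Λ (next i)) x) (Λ≤m (next i))) j)

dropFirstIf-prependIf : ∀ b m p → firstPart p ≤ m → dropFirstIf b (prependIf b m p) ≡ p
dropFirstIf-prependIf true  m p p₁≤m = dropFirst-prepend m p p₁≤m
dropFirstIf-prependIf false m p _    = refl

prependIf-dropFirstIf : ∀ b m p → (T b → firstPart p ≡ m) → prependIf b m (dropFirstIf b p) ≡ p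
prependIf-dropFirstIf true  m p p₁≡m = subst (λ x → prepend x (dropFirst p) ≡ p) (p₁≡m tt) (prepend-dropFirst p)
prependIf-dropFirstIf false m p _    = refl

removeRows-addRows : ∀ {k} m J (Λ : Vec Partition k) → FirstParts≤ m Λ → removeRows J (addRows m J Λ) ≡ Λ
removeRows-addRows m []      []      _   = refl
removeRows-addRows m (b ∷ J) (p ∷ Λ) Λ≤m =
  cong₂ _∷_ (dropFirstIf-prependIf b m p (Λ≤m Fin.zero)) (removeRows-addRows m J Λ (Λ≤m ∘ Fin.suc))

addRows-removeRows : ∀ {k} m J (Λ : Vec Partition k) → FirstParts≡On J m Λ → addRows m J (removeRows J Λ) ≡ Λ
addRows-removeRows m []      []      _    = refl
addRows-removeRows m (b ∷ J) (p ∷ Λ) J≡m =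
  cong₂ _∷_ (prependIf-dropFirstIf b m p (J≡m Fin.zero)) (addRows-removeRows m J Λ (J≡m ∘ Fin.suc))

weight-dropFirstIf : ∀ b m p → (T b → firstPart p ≡ m) → weight p ≡ weight (dropFirstIf b p) + bit b * m
weight-dropFirstIf true  m p p₁≡m = begin
  weight p                              ≡⟨ weight-dropFirst p ⟩
  firstPart p + weight (dropFirst p)    ≡⟨ cong (_+ weight (dropFirst p)) (p₁≡m tt) ⟩
  m + weight (dropFirst p)              ≡⟨ ℕ.+-comm m _ ⟩
  weight (dropFirst p) + m              ≡⟨ cong (λ x → weight (dropFirst p) + x) (ℕ.*-identityˡ m) ⟨
  weight (dropFirst p) + bit true * m   ∎
  where open ≡-Reasoning
weight-dropFirstIf false m p _ = sym (ℕ.+-identityʳ (weight p))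

size-removeRows : ∀ {k} m J (Λ : Vec Partition k) → FirstParts≡On J m Λ →
  size Λ ≡ size (removeRows J Λ) + card J * m
size-removeRows m []      []      _   = refl
size-removeRows m (b ∷ J) (p ∷ Λ) J≡m =
  trans (cong₂ _+_ (weight-dropFirstIf b m p (J≡m Fin.zero)) (size-removeRows m J Λ (J≡m ∘ Fin.suc)))
        (interchange (weight (dropFirstIf b p)) (size (removeRows J Λ)) (bit b) (card J) m)
  where
  interchange : ∀ w s x y m → (w + x * m) + (s + y * m) ≡ (w + s) + (x + y) * m
  interchange = solve-∀

firstPart-addRows : ∀ {k} m J (Λ : Vec Partition k) → FirstParts≤ m Λ → ∀ i →
  firstPart (lookup (addRows m J Λ) i) ≡ consIf (lookup J i) m (part (lookup Λ i)) 0
firstPart-addRows m J Λ Λ≤m i = part-addRows m J Λ Λ≤m i 0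

addRows-FirstParts≤ : ∀ {k} m J (Λ : Vec Partition k) → FirstParts≤ m Λ → FirstParts≤ m (addRows m J Λ)
addRows-FirstParts≤ m J Λ Λ≤m i =
  subst (_≤ m) (sym (firstPart-addRows m J Λ Λ≤m i))
        (consIf-≤ (lookup J i) m _ (λ j → ℕ.≤-trans (part≤firstPart (lookup Λ i) j) (Λ≤m i)) 0)

addRows-FirstParts≡On : ∀ {k} m J (Λ : Vec Partition k) → FirstParts≤ m Λ → FirstParts≡On J m (addRows m J Λ)
addRows-FirstParts≡On m J Λ Λ≤m i i∈J = trans (firstPart-addRows m J Λ Λ≤m i) (consIf-true-0 (lookup J i) i∈J)
  where
  consIf-true-0 : ∀ b → T b → consIf b m (part (lookup Λ i)) 0 ≡ m
  consIf-true-0 true _ = refl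

size-addRows : ∀ {k} m J (Λ : Vec Partition k) → FirstParts≤ m Λ → size (addRows m J Λ) ≡ size Λ + card J * m
size-addRows m J Λ Λ≤m =
  trans (size-removeRows m J (addRows m J Λ) (addRows-FirstParts≡On m J Λ Λ≤m))
        (cong (λ Λ′ → size Λ′ + card J * m) (removeRows-addRows m J Λ Λ≤m))

firstPart≤maxΛ : ∀ {k} (Λ : Vec Partition k) i → firstPart (lookup Λ i) ≤ maxΛ Λ
firstPart≤maxΛ (p ∷ Λ) Fin.zero    = ℕ.m≤m⊔n (firstPart p) (maxΛ Λ)
firstPart≤maxΛ (p ∷ Λ) (Fin.suc i) = ℕ.m≤n⇒m≤o⊔n (firstPart p) (firstPart≤maxΛ Λ i)

maxΛ-lub : ∀ {k} m (Λ : Vec Partition k) → FirstParts≤ m Λ → maxΛ Λ ≤ m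
maxΛ-lub m []      _   = z≤n
maxΛ-lub m (p ∷ Λ) Λ≤m = ℕ.⊔-lub (Λ≤m Fin.zero) (maxΛ-lub m Λ (Λ≤m ∘ Fin.suc))

maxΛ-attained : ∀ {k} (Λ : Vec Partition (suc k)) → ∃ λ i → firstPart (lookup Λ i) ≡ maxΛ Λ
maxΛ-attained (p ∷ []) = Fin.zero , sym (ℕ.⊔-identityʳ (firstPart p))
maxΛ-attained (p ∷ q ∷ Λ) with ℕ.⊔-sel (firstPart p) (maxΛ (q ∷ Λ))
... | inj₁ max≡p = Fin.zero , sym max≡p
... | inj₂ max≡rest = let i , e = maxΛ-attained (q ∷ Λ) in Fin.suc i , trans e (sym max≡rest)

Ic-sound : ∀ {k} (c : Vec ℕ k) J → T (subsetᵇ J (Ic c)) → J ⊆-positive c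
Ic-sound c J J⊆Ic i i∈J =
  ℕ.<ᵇ⇒< 0 (lookup c i) (subst T (lookup-map i (0 <ᵇ_) c) (subsetᵇ-sound J (Ic c) J⊆Ic i i∈J))

topRows : ∀ {k} → ℕ → Vec Partition k → Vec Bool k
topRows m = Vec.map (λ p → firstPart p ≡ᵇ m)

topRows-sound : ∀ {k} m J (Λ : Vec Partition k) → T (subsetᵇ J (topRows m Λ)) → FirstParts≡On J m Λ
topRows-sound m J Λ J⊆top i i∈J =
  ℕ.≡ᵇ⇒≡ _ m (subst T (lookup-map i _ Λ) (subsetᵇ-sound J (topRows m Λ) J⊆top i i∈J))

topRows-complete : ∀ {k} m J (Λ : Vec Partition k) → FirstParts≡On J m Λ → T (subsetᵇ J (topRows m Λ))
topRows-complete m J Λ J≡m = subsetᵇ-complete J (topRows m Λ)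
  (λ i i∈J → subst T (sym (lookup-map i _ Λ)) (ℕ.≡⇒≡ᵇ _ m (J≡m i i∈J)))

CP-≡ : ∀ {k} {c : Vec ℕ k} {m n} {X Y : CP c m n} → proj₁ X ≡ proj₁ Y → X ≡ Y
CP-≡ {X = Λ , _ , max≡ , size≡} {Y = .Λ , _ , max≡′ , size≡′} refl =
  cong₂ (λ u v → Λ , _ , u , v) (ℕ.≡-irrelevant max≡ max≡′) (ℕ.≡-irrelevant size≡ size≡′)

CPTop : ∀ {k} → Vec ℕ k → Vec Bool k → ℕ → ℕ → Set
CPTop c J m n = Σ (CP c m n) (λ X → T (subsetᵇ J (topRows m (proj₁ X))))

CPTop-≡ : ∀ {k} {c : Vec ℕ k} {J m n} {x y : CPTop c J m n} → proj₁ (proj₁ x) ≡ proj₁ (proj₁ y) → x ≡ y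
CPTop-≡ {c = c} {x = X , _} {y = Y , _} Λ≡ with CP-≡ {c = c} {X = X} {Y = Y} Λ≡
... | refl = cong (X ,_) (T-irrelevant _ _)

CP≤ : ∀ {k} → Vec ℕ k → ℕ → ℕ → Set
CP≤ d m n = Σ (Fin (suc m)) (λ t → CP d (toℕ t) n)

CP≤-≡ : ∀ {k} {d : Vec ℕ k} {m n} {x y : CP≤ d m n} → proj₁ (proj₂ x) ≡ proj₁ (proj₂ y) → x ≡ y
CP≤-≡ {d = d} {x = t , Λ , _ , max≡t , _} {y = t′ , .Λ , _ , max≡t′ , _} refl
  with toℕ-injective (trans (sym max≡t) max≡t′)
... | refl = cong (t ,_) (CP-≡ {c = d} refl)

-- After the removal the maximum may be any t ≤ m; the row i₀ ∈ J is what brings the maximum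
-- back to exactly m when the parts are prepended again.
CPTop↔CP≤ : ∀ {k} (c : Vec ℕ k) J m n → J ⊆-positive c →
  ∀ {i₀} → T (lookup J i₀) → card J * m ≤ n →
  CPTop c J m n ↔ CP≤ (cJ c J) m (n ∸ card J * m)
CPTop↔CP≤ c J m n J⊆c {i₀} i₀∈J Jm≤n = mk↔ₛ′ remove add remove∘add add∘remove
  where
  removed≤m : ∀ Λ → maxΛ Λ ≡ m → maxΛ (removeRows J Λ) ≤ m
  removed≤m Λ max≡m = maxΛ-lub m (removeRows J Λ) λ i →
    subst (_≤ m) (sym (part-removeRows J Λ i 0))
      (ℕ.≤-trans (part≤firstPart (lookup Λ i) _)
                 (subst (firstPart (lookup Λ i) ≤_) max≡m (firstPart≤maxΛ Λ i)))

  remove : CPTop c J m n → CP≤ (cJ c J) m (n ∸ card J * m)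
  remove ((Λ , [ cyl ] , max≡m , size≡n) , J⊆top) =
    fromℕ< (s≤s (removed≤m Λ max≡m)) ,
    removeRows J Λ , [ removeRows-cylindric c J Λ J⊆c cyl ] ,
    sym (FP.toℕ-fromℕ< (s≤s (removed≤m Λ max≡m))) ,
    trans (sym (ℕ.m+n∸n≡m (size (removeRows J Λ)) (card J * m)))
          (cong (_∸ card J * m) (trans (sym (size-removeRows m J Λ (topRows-sound m J Λ J⊆top))) size≡n))

  bounded : ∀ (t : Fin (suc m)) Λ → maxΛ Λ ≡ toℕ t → FirstParts≤ m Λ
  bounded t Λ max≡t i =
    ℕ.≤-trans (firstPart≤maxΛ Λ i) (subst (_≤ m) (sym max≡t) (ℕ.≤-pred (FP.toℕ<n t)))

  add : CP≤ (cJ c J) m (n ∸ card J * m) → CPTop c J m n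
  add (t , Λ , [ cyl ] , max≡t , size≡) =
    (addRows m J Λ , [ addRows-cylindric c J m Λ J⊆c Λ≤m cyl ] , max≡m , size≡n) ,
    topRows-complete m J (addRows m J Λ) (addRows-FirstParts≡On m J Λ Λ≤m)
    where
    Λ≤m = bounded t Λ max≡t
    max≡m : maxΛ (addRows m J Λ) ≡ m
    max≡m = ℕ.≤-antisym (maxΛ-lub m (addRows m J Λ) (addRows-FirstParts≤ m J Λ Λ≤m))
      (subst (_≤ maxΛ (addRows m J Λ)) (addRows-FirstParts≡On m J Λ Λ≤m i₀ i₀∈J)
             (firstPart≤maxΛ (addRows m J Λ) i₀))
    size≡n : size (addRows m J Λ) ≡ n
    size≡n = trans (size-addRows m J Λ Λ≤m) (trans (cong (_+ card J * m) size≡) (ℕ.m∸n+n≡m Jm≤n))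

  remove∘add : ∀ y → remove (add y) ≡ y
  remove∘add (t , Λ , _ , max≡t , _) = CP≤-≡ {d = cJ c J} (removeRows-addRows m J Λ (bounded t Λ max≡t))

  add∘remove : ∀ x → add (remove x) ≡ x
  add∘remove ((Λ , _) , J⊆top) = CPTop-≡ {c = c} {J = J} (addRows-removeRows m J Λ (topRows-sound m J Λ J⊆top))

sum≡0 : ∀ {k} (c : Vec ℕ k) → (∀ i → lookup c i ≡ 0) → sum c ≡ 0
sum≡0 []      _   = refl
sum≡0 (x ∷ c) c≡0 = cong₂ _+_ (c≡0 Fin.zero) (sum≡0 c (c≡0 ∘ Fin.suc))

positive-row-attains-maxΛ : ∀ {k} (c : Vec ℕ k) Λ → .(Cylindric c Λ) → 0 < sum c →
  ∃ λ i → 0 < lookup c i × firstPart (lookup Λ i) ≡ maxΛ Λ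
positive-row-attains-maxΛ {zero}  []  []  _   ()
positive-row-attains-maxΛ {suc k} c Λ cyl 0<Σc
  with any? (λ i → (0 <? lookup c i) ×-dec (firstPart (lookup Λ i) ℕ.≟ maxΛ Λ))
... | yes found = found
... | no  none  = ⊥-elim (ℕ.<⇒≢ 0<Σc (sym (sum≡0 c (λ i → c≡0 i (all-top i)))))
  where
  Top : Fin (suc k) → Set
  Top i = firstPart (lookup Λ i) ≡ maxΛ Λ

  c≡0 : ∀ i → Top i → lookup c i ≡ 0
  c≡0 i top = ℕ.n≤0⇒n≡0 (ℕ.≮⇒≥ (λ 0<cᵢ → none (i , 0<cᵢ , top)))

  closed : ∀ i → Top i → Top (prev i)
  closed i top = ℕ.≤-antisym (firstPart≤maxΛ Λ (prev i))
    (subst (_≤ firstPart (lookup Λ (prev i)))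
           (trans (cong (λ x → part (lookup Λ x) (lookup c x)) (next-prev i))
                  (trans (cong (part (lookup Λ i)) (c≡0 i top)) top))
           (recompute (_ ≤? _) (cyl (prev i) 0)))

  all-top : ∀ i → Top i
  all-top = prev-closed⇒all Top closed (proj₂ (maxΛ-attained Λ))

emptyRows : ∀ k → Vec Partition k
emptyRows k = Vec.replicate k emptyPartition

FirstParts≤0⇒emptyRows : ∀ {k} (Λ : Vec Partition k) → FirstParts≤ 0 Λ → Λ ≡ emptyRows k
FirstParts≤0⇒emptyRows []      _   = refl
FirstParts≤0⇒emptyRows (p ∷ Λ) Λ≤0 =
  cong₂ _∷_ (Partition-≡ (firstPart≡0⇒parts≡[] p (ℕ.n≤0⇒n≡0 (Λ≤0 Fin.zero))))
            (FirstParts≤0⇒emptyRows Λ (Λ≤0 ∘ Fin.suc))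

firstPart≤size : ∀ {k} (Λ : Vec Partition k) i → firstPart (lookup Λ i) ≤ size Λ
firstPart≤size (p ∷ Λ) Fin.zero    =
  ℕ.≤-trans (subst (firstPart p ≤_) (sym (weight-dropFirst p)) (ℕ.m≤m+n _ _)) (ℕ.m≤m+n (weight p) (size Λ))
firstPart≤size (p ∷ Λ) (Fin.suc i) = ℕ.≤-trans (firstPart≤size Λ i) (ℕ.m≤n+m (size Λ) (weight p))

maxΛ≡0⇒emptyRows : ∀ {k} (Λ : Vec Partition k) → maxΛ Λ ≡ 0 → Λ ≡ emptyRows k
maxΛ≡0⇒emptyRows Λ max≡0 =
  FirstParts≤0⇒emptyRows Λ (λ i → subst (firstPart (lookup Λ i) ≤_) max≡0 (firstPart≤maxΛ Λ i))

size≡0⇒emptyRows : ∀ {k} (Λ : Vec Partition k) → size Λ ≡ 0 → Λ ≡ emptyRows k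
size≡0⇒emptyRows Λ size≡0 =
  FirstParts≤0⇒emptyRows Λ (λ i → subst (firstPart (lookup Λ i) ≤_) size≡0 (firstPart≤size Λ i))

maxΛ-emptyRows : ∀ k → maxΛ (emptyRows k) ≡ 0
maxΛ-emptyRows zero    = refl
maxΛ-emptyRows (suc k) = maxΛ-emptyRows k

size-emptyRows : ∀ k → size (emptyRows k) ≡ 0
size-emptyRows zero    = refl
size-emptyRows (suc k) = size-emptyRows k

emptyRows-cylindric : ∀ {k} (c : Vec ℕ k) → Cylindric c (emptyRows k)
emptyRows-cylindric c i j rewrite lookup-replicate i emptyPartition | lookup-replicate (next i) emptyPartition = z≤n

CP-0-0↔Fin1 : ∀ {k} (c : Vec ℕ k) → CP c 0 0 ↔ Fin 1
CP-0-0↔Fin1 {k} c = mk↔ₛ′ (λ _ → Fin.zero) (λ _ → emptyCP) (λ { Fin.zero → refl ; (Fin.suc ()) })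
  (λ (Λ , _ , max≡0 , _) → CP-≡ {c = c} (sym (maxΛ≡0⇒emptyRows Λ max≡0)))
  where
  emptyCP : CP c 0 0
  emptyCP = emptyRows k , [ emptyRows-cylindric c ] , maxΛ-emptyRows k , size-emptyRows k

CP-0-suc-empty : ∀ {k} (c : Vec ℕ k) n → ¬ CP c 0 (suc n)
CP-0-suc-empty {k} c n (Λ , _ , max≡0 , size≡1+n) =
  ℕ.0≢1+n (trans (sym (size-emptyRows k)) (trans (cong size (sym (maxΛ≡0⇒emptyRows Λ max≡0))) size≡1+n))

CP-suc-0-empty : ∀ {k} (c : Vec ℕ k) m → ¬ CP c (suc m) 0
CP-suc-0-empty {k} c m (Λ , _ , max≡1+m , size≡0) =
  ℕ.0≢1+n (trans (sym (maxΛ-emptyRows k)) (trans (cong maxΛ (sym (size≡0⇒emptyRows Λ size≡0))) max≡1+m))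

module _ {k} (c : Vec ℕ k) (a : Vec ℕ k → ℕ → ℕ → ℕ) (iso : ∀ d m n → Fin (a d m n) ↔ CP d m n)
         (m n : ℕ) where

  private
    N : ℕ
    N = a c m n

  rowsOf : Fin N → Vec Partition k
  rowsOf x = proj₁ (Inverse.to (iso c m n) x)

  inTop : Vec Bool k → Fin N → Bool
  inTop J x = subsetᵇ J (topRows m (rowsOf x))

  Σ-inTop↔CPTop : ∀ J → Σ (Fin N) (T ∘ inTop J) ↔ CPTop c J m n
  Σ-inTop↔CPTop J = Σ-↔ (iso c m n) ↔-refl

  count-inTop : ∀ J → T (subsetᵇ J (Ic c)) → ∀ {i₀} → T (lookup J i₀) →
    (if card J * m ≤ᵇ n then Σ< (suc m) (λ t → genF a (cJ c J) t (n ∸ card J * m)) else + 0) ≡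
    ∑[ x < N ] (+ bit (inTop J x))
  count-inTop J J⊆Ic i₀∈J with card J * m ≤? n
  ... | yes Jm≤n = begin
    (if card J * m ≤ᵇ n then Σ< (suc m) (λ t → + a c′ t n′) else + 0)  ≡⟨ if-true (ℕ.≤⇒≤ᵇ Jm≤n) ⟩
    Σ< (suc m) (λ t → + a c′ t n′)                                      ≡⟨ Σ<≡∑ (suc m) (λ t → + a c′ t n′) ⟩
    ∑[ t < suc m ] (+ g t)                                              ≡⟨ +-sum g ⟨
    + ℕ∑.sum g                                                          ≡⟨ cong +_ (↔⇒≡ counted) ⟨
    + ℕ∑.sum (bit ∘ inTop J)                                            ≡⟨ +-sum (bit ∘ inTop J) ⟩
    ∑[ x < N ] (+ bit (inTop J x))                                      ∎
    where
    open ≡-Reasoning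
    c′ = cJ c J
    n′ = n ∸ card J * m
    g : Fin (suc m) → ℕ
    g t = a c′ (toℕ t) n′
    counted : Fin (ℕ∑.sum (bit ∘ inTop J)) ↔ Fin (ℕ∑.sum g)
    counted = ↔-trans (↔-sym (Σ-T↔sum-bit (inTop J)))
              (↔-trans (Σ-inTop↔CPTop J)
              (↔-trans (CPTop↔CP≤ c J m n (Ic-sound c J J⊆Ic) i₀∈J Jm≤n)
              (↔-trans (Σ-↔ ↔-refl (↔-sym (iso c′ _ n′)))
                       (Σ-Fin↔sum g))))
  ... | no Jm≰n = begin
    (if card J * m ≤ᵇ n then _ else + 0)  ≡⟨ if-false (Jm≰n ∘ ℕ.≤ᵇ⇒≤ (card J * m) n) ⟩
    + 0                                  ≡⟨ cong +_ (↔⇒≡ (↔-trans (↔-sym (Σ-T↔sum-bit (inTop J)))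
                                                             (↔-trans (Σ-inTop↔CPTop J) none))) ⟨
    + ℕ∑.sum (bit ∘ inTop J)             ≡⟨ +-sum (bit ∘ inTop J) ⟩
    ∑[ x < N ] (+ bit (inTop J x))       ∎
    where
    open ≡-Reasoning
    too-large : CPTop c J m n → ⊥
    too-large ((Λ , _ , _ , size≡n) , J⊆top) = Jm≰n (subst (card J * m ≤_) size≡n
      (subst (card J * m ≤_) (sym (size-removeRows m J Λ (topRows-sound m J Λ J⊆top))) (ℕ.m≤n+m _ _)))
    none : CPTop c J m n ↔ Fin 0
    none = mk↔ₛ′ (⊥-elim ∘ too-large) (λ ()) (λ ()) (⊥-elim ∘ too-large)

  private
    if-*-∑ : ∀ b s (f : Fin N → ℤ) {v} → (T b → v ≡ ∑[ x < N ] f x) →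
      (if b then s *ℤ v else + 0) ≡ ∑[ x < N ] (if b then s *ℤ f x else + 0)
    if-*-∑ true  s f v≡∑f = trans (cong (s *ℤ_) (v≡∑f tt)) (ℤ∑.*-distribˡ-sum s f)
    if-*-∑ false s f _    = sym (ℤ∑.sum-replicate-zero N)

  rhs-term-as-∑ : ∀ J →
    (if subsetᵇ J (Ic c) ∧ (0 <ᵇ card J)
       then ((-1ℤ ^ (card J ∸ 1)) ·ₛ (substYq (card J) (genF a (cJ c J)) *ₛ geom (card J))) m n
       else + 0) ≡
    ∑[ x < N ] nonemptySubsetSign (Vec.zipWith _∧_ (Ic c) (topRows m (rowsOf x))) J
  rhs-term-as-∑ J =
    trans (if-*-∑ (subsetᵇ J (Ic c) ∧ (0 <ᵇ card J)) (-1ℤ ^ (card J ∸ 1)) (λ x → + bit (inTop J x)) counted)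
          (sym (ℤ∑.sum-cong-≗ (λ x → nonemptySubsetSign-∧ (Ic c) (topRows m (rowsOf x)) J)))
    where
    counted : T (subsetᵇ J (Ic c) ∧ (0 <ᵇ card J)) →
      (substYq (card J) (genF a (cJ c J)) *ₛ geom (card J)) m n ≡ ∑[ x < N ] (+ bit (inTop J x))
    counted P with Equivalence.to T-∧ P
    ... | J⊆Ic , J≢∅ = let i₀ , i₀∈J = card-pos⇒member J (ℕ.<ᵇ⇒< 0 (card J) J≢∅) in
      trans (coeff-substYq-*-geom (card J) (genF a (cJ c J)) m n) (count-inTop J J⊆Ic i₀∈J)

  topRows-meets-Ic : 0 < sum c → ∀ x → 0 < card (Vec.zipWith _∧_ (Ic c) (topRows m (rowsOf x)))
  topRows-meets-Ic 0<Σc x with Inverse.to (iso c m n) x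
  ... | Λ , [ cyl ] , max≡m , _ =
    let i , 0<cᵢ , top = positive-row-attains-maxΛ c Λ cyl 0<Σc in
    member⇒card-pos (Vec.zipWith _∧_ (Ic c) (topRows m Λ)) i
      (subst T (sym (lookup-zipWith _∧_ i (Ic c) (topRows m Λ)))
      (Equivalence.from T-∧ ( subst T (sym (lookup-map i (0 <ᵇ_) c)) (ℕ.<⇒<ᵇ 0<cᵢ)
                            , subst T (sym (lookup-map i _ Λ)) (ℕ.≡⇒≡ᵇ _ m (trans top max≡m)))))

  coeff-rhs : 0 < sum c → rhs a c m n ≡ + N
  coeff-rhs 0<Σc = begin
    rhs a c m n
      ≡⟨ foldr-+ₛ-apply term (List.filter (T? ∘ P) (allSubsets k)) m n ⟩
    sumℤ (List.map (λ J → term J m n) (List.filter (T? ∘ P) (allSubsets k)))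
      ≡⟨ sumℤ-filter P (λ J → term J m n) (allSubsets k) ⟩
    sumℤ (List.map (λ J → if P J then term J m n else + 0) (allSubsets k))
      ≡⟨ sumℤ-map-cong rhs-term-as-∑ (allSubsets k) ⟩
    sumℤ (List.map (λ J → ∑[ x < N ] nonemptySubsetSign (S x) J) (allSubsets k))
      ≡⟨ sumℤ-map-∑ (λ J x → nonemptySubsetSign (S x) J) (allSubsets k) ⟩
    ∑[ x < N ] sumℤ (List.map (nonemptySubsetSign (S x)) (allSubsets k))
      ≡⟨ ℤ∑.sum-cong-≗ (λ x → trans (∑-nonemptySubsetSign (S x))
                                   (cong (+_ ∘ bit) (Equivalence.to T-≡ (ℕ.<⇒<ᵇ (topRows-meets-Ic 0<Σc x))))) ⟩
    ∑[ x < N ] (+ 1)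
      ≡⟨ ∑-one N ⟩
    + N ∎
    where
    open ≡-Reasoning
    P : Vec Bool k → Bool
    P J = subsetᵇ J (Ic c) ∧ (0 <ᵇ card J)
    term : Vec Bool k → Series
    term J = (-1ℤ ^ (card J ∸ 1)) ·ₛ (substYq (card J) (genF a (cJ c J)) *ₛ geom (card J))
    S : Fin N → Vec Bool k
    S x = Vec.zipWith _∧_ (Ic c) (topRows m (rowsOf x))

proposition3p1 : (k : ℕ) → 1 < k → (c : Vec ℕ k) → 0 < sum c →
    (a : Vec ℕ k → ℕ → ℕ → ℕ) →
    (∀ d m n → Fin (a d m n) ↔ CP d m n) →
    (genF a c ≈ₛ rhs a c) × (atY0 (genF a c) ≈₁ one₁) × (atQ0 (genF a c) ≈₁ one₁)
proposition3p1 k _ c 0<Σc a iso = (λ m n → sym (coeff-rhs c a iso m n 0<Σc)) , at-y=0 , at-q=0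
  where
  a₀₀≡1 : a c 0 0 ≡ 1
  a₀₀≡1 = ↔⇒≡ (↔-trans (iso c 0 0) (CP-0-0↔Fin1 c))
  at-y=0 : atY0 (genF a c) ≈₁ one₁
  at-y=0 zero    = cong +_ a₀₀≡1
  at-y=0 (suc n) = cong +_ (↔-empty⇒≡0 (iso c 0 (suc n)) (CP-0-suc-empty c n))
  at-q=0 : atQ0 (genF a c) ≈₁ one₁
  at-q=0 zero    = cong +_ a₀₀≡1
  at-q=0 (suc m) = cong +_ (↔-empty⇒≡0 (iso c (suc m) 0) (CP-suc-0-empty c m))
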